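{- Let $G=(V,E)$ be a finite simple graph and let $A,B,C_1,\dots,C_k\in\operatorname{Stab}(G)$ ($k\ge 1$) be such that the vectors $e_A,e_B,e_{C_1},\dots,e_{C_k}$ are pairwise distinct. If there exist $\gamma_1,\dots,\gamma_k>0$ with $$e_A-e_B=\sum_{i=1}^k\gamma_i\,(e_{C_i}-e_B),$$ then $A\cap B\subseteq C_i\subseteq A\cup B$ for all $i\in\{1,\dots,k\}$.
   Context: For a finite set $X$, $\mathbb{R}^X$ denotes the real vector space with standard basis $\{e_x : x\in X\}$, and for $A\subseteq X$ the indicator vector is $e_A=\sum_{a\in A}e_a$. For a simple graph $G=(V,E)$, a subset $A\subseteq V$ is stable if no two vertices of $A$ are adjacent in $G$; $\operatorname{Stab}(G)$ denotes the set of stable sets of $G$. -}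

module Defs where

open import Level using (Level; suc; _⊔_)
open import Data.Nat using (ℕ; zero) renaming (suc to sucℕ)
open import Data.Fin using (Fin) renaming (zero to fzero; suc to fsuc)
open import Data.Fin.Subset using (Subset; _∈_)
open import Data.Vec using (lookup)
open import Data.Bool using (true; false)
open import Relation.Nullary using (¬_)
open import Relation.Binary.Core using (Rel)
open import Relation.Binary.Structures using (IsStrictTotalOrder)
open import Algebra.Bundles using (CommutativeRing)
open import Data.Product using (Σ)

record SimpleGraph (n : ℕ) : Set₁ where
  field
    Adj    : Fin n → Fin n → Set
    sym    : ∀ {x y} → Adj x y → Adj y x
    irrefl : ∀ {x} → ¬ Adj x x

Stable : ∀ {n} → SimpleGraph n → Subset n → Set
Stable G A = ∀ x y → x ∈ A → y ∈ A → ¬ SimpleGraph.Adj G x y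

-- An ordered field (the theorem is stated for an arbitrary ordered field,
-- which in particular covers the real numbers).
record OrderedField (c ℓ₁ ℓ₂ : Level) : Set (suc (c ⊔ ℓ₁ ⊔ ℓ₂)) where
  field
    commutativeRing : CommutativeRing c ℓ₁
  open CommutativeRing commutativeRing public
  field
    _<_                 : Rel Carrier ℓ₂
    isStrictTotalOrder  : IsStrictTotalOrder _≈_ _<_
    0<1                 : 0# < 1#
    +-mono-<            : ∀ {x y} z → x < y → (x + z) < (y + z)
    *-pos               : ∀ {x y} → 0# < x → 0# < y → 0# < (x * y)
    inverse             : ∀ x → ¬ (x ≈ 0#) → Σ Carrier (λ y → (x * y) ≈ 1#)

module _ {c ℓ₁ ℓ₂} (F : OrderedField c ℓ₁ ℓ₂) where
  open OrderedField F

  e : ∀ {n} → Subset n → Fin n → Carrier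
  e A v with lookup A v
  ... | true  = 1#
  ... | false = 0#

  ∑ : ∀ k → (Fin k → Carrier) → Carrier
  ∑ zero     f = 0#
  ∑ (sucℕ k) f = f fzero + ∑ k (λ i → f (fsuc i))

  _≈ᵛ_ : ∀ {n} → (Fin n → Carrier) → (Fin n → Carrier) → Set ℓ₁
  u ≈ᵛ w = ∀ v → u v ≈ w v

-- At a vertex v lying in both A and B, or in neither, the left-hand side vanishes.
-- In the first case every summand γ_j (e_{C_j}(v) − 1) is ≤ 0, and the i-th one is
-- < 0 unless v ∈ C_i; in the second every summand γ_j e_{C_j}(v) is ≥ 0, and the
-- i-th one is > 0 if v ∈ C_i. Either way the sum would be nonzero.
module Submission where

open import Defs
open import Data.Nat using (ℕ; zero; suc)
open import Data.Fin using (Fin) renaming (zero to fzero; suc to fsuc)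
open import Data.Fin.Subset using (Subset; _⊆_; _∩_; _∪_; _∈_; _∉_)
open import Data.Fin.Subset.Properties using (_∈?_; x∈p∩q⁻; x∈p∪q⁺)
open import Data.Product using (Σ; _×_; _,_)
open import Data.Sum using (inj₁; inj₂)
open import Data.Bool using (true; false)
open import Data.Vec using (lookup)
open import Data.Vec.Properties using ([]=⇒lookup; lookup⇒[]=)
open import Relation.Nullary using (¬_; yes; no; contradiction)
open import Relation.Binary.Bundles using (StrictPartialOrder)
open import Relation.Binary.Structures using (IsStrictTotalOrder)
import Algebra.Properties.Ring as RingProperties
import Relation.Binary.Reasoning.StrictPartialOrder as StrictReasoning
import Relation.Binary.Reasoning.Setoid as SetoidReasoning

module OrderedFieldProperties {c ℓ₁ ℓ₂} (F : OrderedField c ℓ₁ ℓ₂) where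
  open OrderedField F
  open IsStrictTotalOrder isStrictTotalOrder using (isStrictPartialOrder)

  <-strictPartialOrder : StrictPartialOrder c ℓ₁ ℓ₂
  <-strictPartialOrder = record { isStrictPartialOrder = isStrictPartialOrder }

  open import Relation.Binary.Construct.StrictToNonStrict _≈_ _<_ public using (_≤_)
  open StrictReasoning <-strictPartialOrder
  open RingProperties ring using (-‿distribʳ-*; -0#≈0#)

  +-monoʳ-< : ∀ z {x y} → x < y → (z + x) < (z + y)
  +-monoʳ-< z {x} {y} x<y = begin-strict
    z + x  ≈⟨ +-comm z x ⟩
    x + z  <⟨ +-mono-< z x<y ⟩
    y + z  ≈⟨ +-comm y z ⟩
    z + y  ∎

  +-monoˡ-≤ : ∀ z {x y} → x ≤ y → (x + z) ≤ (y + z)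
  +-monoˡ-≤ z (inj₁ x<y) = inj₁ (+-mono-< z x<y)
  +-monoˡ-≤ z (inj₂ x≈y) = inj₂ (+-congʳ x≈y)

  +-monoʳ-≤ : ∀ z {x y} → x ≤ y → (z + x) ≤ (z + y)
  +-monoʳ-≤ z (inj₁ x<y) = inj₁ (+-monoʳ-< z x<y)
  +-monoʳ-≤ z (inj₂ x≈y) = inj₂ (+-congˡ x≈y)

  +-mono-≤ : ∀ {x y u w} → x ≤ y → u ≤ w → (x + u) ≤ (y + w)
  +-mono-≤ {x} {y} {u} {w} x≤y u≤w = begin
    x + u  ≤⟨ +-monoˡ-≤ u x≤y ⟩
    y + u  ≤⟨ +-monoʳ-≤ y u≤w ⟩
    y + w  ∎

  +-mono-<-≤ : ∀ {x y u w} → x < y → u ≤ w → (x + u) < (y + w)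
  +-mono-<-≤ {x} {y} {u} {w} x<y u≤w = begin-strict
    x + u  <⟨ +-mono-< u x<y ⟩
    y + u  ≤⟨ +-monoʳ-≤ y u≤w ⟩
    y + w  ∎

  +-mono-≤-< : ∀ {x y u w} → x ≤ y → u < w → (x + u) < (y + w)
  +-mono-≤-< {x} {y} {u} {w} x≤y u<w = begin-strict
    x + u  ≤⟨ +-monoˡ-≤ u x≤y ⟩
    y + u  <⟨ +-monoʳ-< y u<w ⟩
    y + w  ∎

  ∑-mono-≤ : ∀ k {f g : Fin k → Carrier} → (∀ j → f j ≤ g j) → ∑ F k f ≤ ∑ F k g
  ∑-mono-≤ zero    f≤g = inj₂ refl
  ∑-mono-≤ (suc k) f≤g = +-mono-≤ (f≤g fzero) (∑-mono-≤ k (λ j → f≤g (fsuc j)))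

  ∑-mono-< : ∀ k {f g : Fin k → Carrier} → (∀ j → f j ≤ g j) →
             ∀ i → f i < g i → ∑ F k f < ∑ F k g
  ∑-mono-< (suc k) f≤g fzero    fi<gi = +-mono-<-≤ fi<gi (∑-mono-≤ k (λ j → f≤g (fsuc j)))
  ∑-mono-< (suc k) f≤g (fsuc i) fi<gi = +-mono-≤-< (f≤g fzero) (∑-mono-< k (λ j → f≤g (fsuc j)) i fi<gi)

  ∑-zero : ∀ k → ∑ F k (λ _ → 0#) ≈ 0#
  ∑-zero zero    = refl
  ∑-zero (suc k) = trans (+-congˡ (∑-zero k)) (+-identityˡ 0#)

  ∑-pos : ∀ k {f : Fin k → Carrier} → (∀ j → 0# ≤ f j) → ∀ i → 0# < f i → 0# < ∑ F k f
  ∑-pos k 0≤f i 0<fi = begin-strict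
    0#                   ≈⟨ ∑-zero k ⟨
    ∑ F k (λ _ → 0#)     <⟨ ∑-mono-< k 0≤f i 0<fi ⟩
    ∑ F k _              ∎

  ∑-neg : ∀ k {f : Fin k → Carrier} → (∀ j → f j ≤ 0#) → ∀ i → f i < 0# → ∑ F k f < 0#
  ∑-neg k f≤0 i fi<0 = begin-strict
    ∑ F k _              <⟨ ∑-mono-< k f≤0 i fi<0 ⟩
    ∑ F k (λ _ → 0#)     ≈⟨ ∑-zero k ⟩
    0#                   ∎

  -‿neg : ∀ {x} → 0# < x → (- x) < 0#
  -‿neg {x} 0<x = begin-strict
    - x        ≈⟨ +-identityˡ (- x) ⟨
    0# + - x   <⟨ +-mono-< (- x) 0<x ⟩
    x + - x    ≈⟨ -‿inverseʳ x ⟩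
    0#         ∎

  *-[1-0] : ∀ x → (x * (1# - 0#)) ≈ x
  *-[1-0] x = begin-equality
    x * (1# - 0#)   ≈⟨ *-congˡ (+-congˡ -0#≈0#) ⟩
    x * (1# + 0#)   ≈⟨ *-congˡ (+-identityʳ 1#) ⟩
    x * 1#          ≈⟨ *-identityʳ x ⟩
    x               ∎

  *-[0-1] : ∀ x → (x * (0# - 1#)) ≈ (- x)
  *-[0-1] x = begin-equality
    x * (0# - 1#)   ≈⟨ *-congˡ (+-identityˡ (- 1#)) ⟩
    x * - 1#        ≈⟨ -‿distribʳ-* x 1# ⟨
    - (x * 1#)      ≈⟨ -‿cong (*-identityʳ x) ⟩
    - x             ∎

  x≈y⇒x-y≈0 : ∀ {x y} → x ≈ y → (x - y) ≈ 0#
  x≈y⇒x-y≈0 {y = y} x≈y = trans (+-congʳ x≈y) (-‿inverseʳ y)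

module Indicator {c ℓ₁ ℓ₂} (F : OrderedField c ℓ₁ ℓ₂) {n : ℕ} where
  open OrderedField F
  open OrderedFieldProperties F

  e-∈ : ∀ {X : Subset n} {v} → v ∈ X → e F X v ≈ 1#
  e-∈ {X} {v} v∈X rewrite []=⇒lookup v∈X = refl

  e-∉ : ∀ {X : Subset n} {v} → v ∉ X → e F X v ≈ 0#
  e-∉ {X} {v} v∉X with lookup X v in eq
  ... | true  = contradiction (lookup⇒[]= v X eq) v∉X
  ... | false = refl

  module _ {γ : Carrier} (0<γ : 0# < γ) {X Y : Subset n} {v : Fin n} where
    open SetoidReasoning setoid
    open IsStrictTotalOrder isStrictTotalOrder using (<-respˡ-≈; <-respʳ-≈)

    scaled-diff-< : v ∉ X → v ∈ Y → (γ * (e F X v - e F Y v)) < 0#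
    scaled-diff-< v∉X v∈Y = <-respˡ-≈ (sym (begin
      γ * (e F X v - e F Y v)   ≈⟨ *-congˡ (+-cong (e-∉ v∉X) (-‿cong (e-∈ v∈Y))) ⟩
      γ * (0# - 1#)             ≈⟨ *-[0-1] γ ⟩
      - γ                       ∎)) (-‿neg 0<γ)

    scaled-diff-> : v ∈ X → v ∉ Y → 0# < (γ * (e F X v - e F Y v))
    scaled-diff-> v∈X v∉Y = <-respʳ-≈ (sym (begin
      γ * (e F X v - e F Y v)   ≈⟨ *-congˡ (+-cong (e-∈ v∈X) (-‿cong (e-∉ v∉Y))) ⟩
      γ * (1# - 0#)             ≈⟨ *-[1-0] γ ⟩
      γ                         ∎)) 0<γ

    scaled-diff-≈0 : e F X v ≈ e F Y v → (γ * (e F X v - e F Y v)) ≈ 0#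
    scaled-diff-≈0 eX≈eY = trans (*-congˡ (x≈y⇒x-y≈0 eX≈eY)) (zeroʳ γ)

    scaled-diff-≤ : v ∈ Y → (γ * (e F X v - e F Y v)) ≤ 0#
    scaled-diff-≤ v∈Y with v ∈? X
    ... | yes v∈X = inj₂ (scaled-diff-≈0 (trans (e-∈ v∈X) (sym (e-∈ v∈Y))))
    ... | no  v∉X = inj₁ (scaled-diff-< v∉X v∈Y)

    scaled-diff-≥ : v ∉ Y → 0# ≤ (γ * (e F X v - e F Y v))
    scaled-diff-≥ v∉Y with v ∈? X
    ... | yes v∈X = inj₁ (scaled-diff-> v∈X v∉Y)
    ... | no  v∉X = inj₂ (sym (scaled-diff-≈0 (trans (e-∉ v∉X) (sym (e-∉ v∉Y)))))

-- Imported only here so as not to clash with the field's non-strict order above.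
open import Data.Nat using (_≤_)
open import Relation.Binary.PropositionalEquality using (_≡_)

lemma3p3 : ∀ {c ℓ₁ ℓ₂} (F : OrderedField c ℓ₁ ℓ₂) →
    let open OrderedField F in
    ∀ {n : ℕ} (G : SimpleGraph n) (k : ℕ) → 1 ≤ k →
    (A B : Subset n) (C : Fin k → Subset n) →
    Stable G A → Stable G B → (∀ i → Stable G (C i)) →
    -- e_A, e_B, e_{C_1}, …, e_{C_k} pairwise distinct
    ¬ (_≈ᵛ_ F (e F A) (e F B)) →
    (∀ i → ¬ (_≈ᵛ_ F (e F A) (e F (C i)))) →
    (∀ i → ¬ (_≈ᵛ_ F (e F B) (e F (C i)))) →
    (∀ i j → ¬ (i ≡ j) → ¬ (_≈ᵛ_ F (e F (C i)) (e F (C j)))) →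
    -- there exist γ_1, …, γ_k > 0 with e_A − e_B = Σ γ_i (e_{C_i} − e_B)
    Σ (Fin k → Carrier) (λ γ →
      (∀ i → 0# < γ i) ×
      (∀ v → (e F A v - e F B v) ≈ ∑ F k (λ i → γ i * (e F (C i) v - e F B v)))) →
    ∀ i → ((A ∩ B) ⊆ C i) × (C i ⊆ (A ∪ B))
lemma3p3 F {n} _ k _ A B C _ _ _ _ _ _ _ (γ , 0<γ , eA-eB≈∑) i = A∩B⊆Cᵢ , Cᵢ⊆A∪B
  where
  open OrderedField F
  open IsStrictTotalOrder isStrictTotalOrder using (irrefl)
  open OrderedFieldProperties F
  open Indicator F

  summand : Fin n → Fin k → Carrier
  summand v j = γ j * (e F (C j) v - e F B v)

  ∑-summand-≈0 : ∀ {v} → e F A v ≈ e F B v → ∑ F k (summand v) ≈ 0#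
  ∑-summand-≈0 {v} eA≈eB = trans (sym (eA-eB≈∑ v)) (x≈y⇒x-y≈0 eA≈eB)

  A∩B⊆Cᵢ : (A ∩ B) ⊆ C i
  A∩B⊆Cᵢ {v} v∈A∩B with x∈p∩q⁻ A B v∈A∩B | v ∈? C i
  ... | _ | yes v∈Cᵢ = v∈Cᵢ
  ... | v∈A , v∈B | no v∉Cᵢ = contradiction
    (∑-neg k (λ j → scaled-diff-≤ (0<γ j) {X = C j} v∈B) i (scaled-diff-< (0<γ i) {X = C i} v∉Cᵢ v∈B))
    (irrefl (∑-summand-≈0 (trans (e-∈ v∈A) (sym (e-∈ v∈B)))))

  Cᵢ⊆A∪B : C i ⊆ (A ∪ B)
  Cᵢ⊆A∪B {v} v∈Cᵢ with v ∈? A | v ∈? B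
  ... | yes v∈A | _       = x∈p∪q⁺ (inj₁ v∈A)
  ... | no  _   | yes v∈B = x∈p∪q⁺ (inj₂ v∈B)
  ... | no  v∉A | no  v∉B = contradiction
    (∑-pos k (λ j → scaled-diff-≥ (0<γ j) {X = C j} v∉B) i (scaled-diff-> (0<γ i) {X = C i} v∈Cᵢ v∉B))
    (irrefl (sym (∑-summand-≈0 (trans (e-∉ v∉A) (sym (e-∉ v∉B))))))
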